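{- Let $m,n\ge1$. If $(\mu,\nu)$ and $(\mu',\nu')$ are two points of positive integers (with ordered parts, $\mu,\mu'$ of length $m$ and $\nu,\nu'$ of length $n$, $\sum\mu_i=\sum\nu_j$, $\sum\mu'_i=\sum\nu'_j$) lying in the same chamber of the resonance arrangement in $R_{m,n}$, then $CP(\mu,\nu)=CP(\mu',\nu')$.
   Context: $[k]=\{1,\dots,k\}$, $|\mu_I|=\sum_{i\in I}\mu_i$. $R_{m,n}=\{(\mu,\nu)\in\mathbb{R}^{m+n}_{>0}:\sum\mu_i=\sum\nu_j\}$; for $(I,J)\ne(\emptyset,\emptyset),([m],[n])$ the wall $W_{I,J}$ is $\{|\mu_I|=|\nu_J|\}\cap R_{m,n}$; chambers are connected components of the complement of the walls. Commutation patterns (for $(\mu,\nu)$ in a chamber): let $e(I,J)=|\mu_I|-|\nu_J|$. A word is a sequence $((I_1,J_1),\dots,(I_k,J_k))$ with the $I_p$ pairwise disjoint with union $[m]$ and the $J_p$ pairwise disjoint with union $[n]$. The initial word is $((\{1\},\emptyset),\dots,(\{m\},\emptyset),(\emptyset,\{1\}),\dots,(\emptyset,\{n\}))$. For a word of length $k\ge2$, let $p$ be the largest index with $e(I_p,J_p)>0$; if $p=k$ the word is dead; otherwise, with $(K,L)=(I_{p+1},J_{p+1})$, it has a passing child (swap entries $p,p+1$) and a canceling child (replace them by $(I_p\cup K,J_p\cup L)$, recording the quadruple $(I_p,J_p,K,L)$). A word of length 1 is successful. A commutation pattern is the sequence of $m+n-1$ recorded quadruples along a path from the initial word to a successful word;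 $CP(\mu,\nu)$ is the set of these. -}

module Defs where

open import Data.Nat using (ℕ; zero; suc; _+_; _<_; _≤_)
open import Data.Bool using (Bool; true; false)
open import Data.Fin using (Fin; zero; suc)
open import Data.Fin.Subset using (Subset; ⊥; ⊤; ⁅_⁆; _∪_)
open import Data.Vec using (Vec; []; _∷_)
open import Data.List using (List; []; _∷_; _++_; map; allFin)
open import Data.List.Relation.Unary.All using (All)
open import Data.Product using (_×_)
open import Relation.Binary.PropositionalEquality using (_≡_)
open import Relation.Nullary using (¬_)
open import Function.Bundles using (_⇔_)

ΣS : ∀ {m} → Subset m → (Fin m → ℕ) → ℕ
ΣS [] f = 0
ΣS (true ∷ s) f = f zero + ΣS s (λ i → f (suc i))
ΣS (false ∷ s) f = ΣS s (λ i → f (suc i))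

IsPoint : ∀ {m n} → (Fin m → ℕ) → (Fin n → ℕ) → Set
IsPoint μ ν = (∀ i → 1 ≤ μ i) × (∀ j → 1 ≤ ν j) × (ΣS ⊤ μ ≡ ΣS ⊤ ν)

IsWallIndex : ∀ {m n} → Subset m → Subset n → Set
IsWallIndex I J = ¬ (I ≡ ⊥ × J ≡ ⊥) × ¬ (I ≡ ⊤ × J ≡ ⊤)

OffWalls : ∀ {m n} → (Fin m → ℕ) → (Fin n → ℕ) → Set
OffWalls {m} {n} μ ν = ∀ (I : Subset m) (J : Subset n) → IsWallIndex I J → ¬ (ΣS I μ ≡ ΣS J ν)

SameChamber : ∀ {m n} → (Fin m → ℕ) → (Fin n → ℕ) → (Fin m → ℕ) → (Fin n → ℕ) → Set
SameChamber {m} {n} μ ν μ' ν' =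
  OffWalls μ ν × OffWalls μ' ν' ×
  (∀ (I : Subset m) (J : Subset n) → IsWallIndex I J → (ΣS I μ < ΣS J ν) ⇔ (ΣS I μ' < ΣS J ν'))

Letter : ℕ → ℕ → Set
Letter m n = Subset m × Subset n

Word : ℕ → ℕ → Set
Word m n = List (Letter m n)

Quad : ℕ → ℕ → Set
Quad m n = Subset m × Subset n × Subset m × Subset n

EPos : ∀ {m n} → (Fin m → ℕ) → (Fin n → ℕ) → Letter m n → Set
EPos μ ν (I Data.Product., J) = ΣS J ν < ΣS I μ

initialWord : ∀ m n → Word m n
initialWord m n = map (λ i → (⁅ i ⁆ Data.Product., ⊥)) (allFin m) ++ map (λ j → (⊥ Data.Product., ⁅ j ⁆)) (allFin n)

-- Path μ ν w qs : following the process from word w one reaches a successful word,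
-- recording the quadruples qs. The pivot p is the largest index with e > 0, i.e.
-- w = pre ++ a ∷ b ∷ post with e(a) > 0 and e ≤ 0 on b ∷ post (so p < k).
data Path {m n} (μ : Fin m → ℕ) (ν : Fin n → ℕ) : Word m n → List (Quad m n) → Set where
  success : ∀ x → Path μ ν (x ∷ []) []
  passing : ∀ {w qs} pre I J K L post →
    w ≡ pre ++ (I Data.Product., J) ∷ (K Data.Product., L) ∷ post →
    EPos μ ν (I Data.Product., J) →
    All (λ x → ¬ EPos μ ν x) ((K Data.Product., L) ∷ post) →
    Path μ ν (pre ++ (K Data.Product., L) ∷ (I Data.Product., J) ∷ post) qs →
    Path μ ν w qs
  canceling : ∀ {w qs} pre I J K L post →
    w ≡ pre ++ (I Data.Product., J) ∷ (K Data.Product., L) ∷ post →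
    EPos μ ν (I Data.Product., J) →
    All (λ x → ¬ EPos μ ν x) ((K Data.Product., L) ∷ post) →
    Path μ ν (pre ++ ((I ∪ K) Data.Product., (J ∪ L)) ∷ post) qs →
    Path μ ν w ((I Data.Product., J Data.Product., K Data.Product., L) ∷ qs)

CP : ∀ {m n} → (Fin m → ℕ) → (Fin n → ℕ) → List (Quad m n) → Set
CP {m} {n} μ ν qs = Path μ ν (initialWord m n) qs

{-# OPTIONS --safe #-}
module Submission where

-- The process generating commutation patterns consults the point (μ,ν) only
-- through the signs of e(I,J) = |μ_I| - |ν_J| for letters (I,J) of words.
-- A letter with e(I,J) > 0 is neither (∅,∅) nor ([m],[n]), so it indexes a
-- wall, and two points in the same chamber lie on the same side of every wall.
-- Hence both points have the same positive letters, and every path of the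
-- process for one point is, step by step, a path for the other.

open import Defs
open import Data.Nat using (ℕ; _≤_; _<_; zero; suc)
open import Data.Nat.Properties using (<-cmp; <-irrefl; <-asym)
open import Data.Fin using (Fin)
open import Data.Fin.Subset using (⊥)
open import Data.List using (List)
import Data.List.Relation.Unary.All as All
open import Data.Product using (_,_)
open import Relation.Binary using (tri<; tri≈; tri>)
open import Relation.Binary.PropositionalEquality using (_≡_; refl; sym; trans)
open import Relation.Nullary using (contradiction; contraposition)
open import Function.Bundles using (_⇔_; mk⇔; Equivalence)
import Function.Properties.Equivalence as ⇔

private
  variable
    m n : ℕ
    μ μ' : Fin m → ℕ
    ν ν' : Fin n → ℕ

ΣS-⊥ : (f : Fin m → ℕ) → ΣS ⊥ f ≡ 0
ΣS-⊥ {zero}  f = refl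
ΣS-⊥ {suc m} f = ΣS-⊥ (λ i → f (Fin.suc i))

EPos⇒IsWallIndex : IsPoint μ ν → ∀ {I J} → EPos μ ν (I , J) → IsWallIndex I J
EPos⇒IsWallIndex {μ = μ} {ν = ν} (_ , _ , total) ν<μ =
    (λ { (refl , refl) → <-irrefl (trans (ΣS-⊥ ν) (sym (ΣS-⊥ μ))) ν<μ })
  , (λ { (refl , refl) → <-irrefl (sym total) ν<μ })

EPos-transfer : IsPoint μ ν → OffWalls μ' ν' →
  (∀ I J → IsWallIndex I J → ΣS I μ' < ΣS J ν' → ΣS I μ < ΣS J ν) →
  ∀ x → EPos μ ν x → EPos μ' ν' x
EPos-transfer {μ' = μ'} {ν' = ν'} point off' below⇒below (I , J) ν<μ
  with wall ← EPos⇒IsWallIndex point ν<μ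
  with <-cmp (ΣS I μ') (ΣS J ν')
... | tri< μ'<ν' _ _ = contradiction (below⇒below I J wall μ'<ν') (<-asym ν<μ)
... | tri≈ _ μ'≡ν' _ = contradiction μ'≡ν' (off' I J wall)
... | tri> _ _ ν'<μ' = ν'<μ'

sameChamber⇒EPos⇔ : IsPoint μ ν → IsPoint μ' ν' → SameChamber μ ν μ' ν' →
  ∀ x → EPos μ ν x ⇔ EPos μ' ν' x
sameChamber⇒EPos⇔ point point' (off , off' , sides) x = mk⇔
  (EPos-transfer point off' (λ I J wall → Equivalence.from (sides I J wall)) x)
  (EPos-transfer point' off (λ I J wall → Equivalence.to (sides I J wall)) x)

Path-transport : (∀ x → EPos μ ν x ⇔ EPos μ' ν' x) →
  ∀ {w qs} → Path μ ν w qs → Path μ' ν' w qs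
Path-transport same (success x) = success x
Path-transport same (passing pre I J K L post eq pos rest path) =
  passing pre I J K L post eq (Equivalence.to (same (I , J)) pos)
    (All.map (λ {x} → contraposition (Equivalence.from (same x))) rest)
    (Path-transport same path)
Path-transport same (canceling pre I J K L post eq pos rest path) =
  canceling pre I J K L post eq (Equivalence.to (same (I , J)) pos)
    (All.map (λ {x} → contraposition (Equivalence.from (same x))) rest)
    (Path-transport same path)

lemma4p1 : ∀ (m n : ℕ) → 1 ≤ m → 1 ≤ n →
    (μ μ' : Fin m → ℕ) (ν ν' : Fin n → ℕ) →
    IsPoint μ ν → IsPoint μ' ν' → SameChamber μ ν μ' ν' →
    ∀ (qs : List (Quad m n)) → CP μ ν qs ⇔ CP μ' ν' qs
lemma4p1 m n _ _ μ μ' ν ν' point point' chamber qs =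
  mk⇔ (Path-transport same) (Path-transport (λ x → ⇔.sym (same x)))
  where
  same : ∀ x → EPos μ ν x ⇔ EPos μ' ν' x
  same = sameChamber⇒EPos⇔ point point' chamber
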